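{- Let $S$ be a closed context-free semi-Thue system over $\Sigma$. The contraction rule $\mathit{ctr}$, which derives $\Gamma,\Delta$ from $\Gamma,\Delta,\Delta$, is admissible in $\mathrm{DKm}(S)$.
   Context: $\Sigma$: alphabet with involution $a\mapsto\bar a$; $\overline{a_1\cdots a_n}=\bar a_n\cdots\bar a_1$. A semi-Thue system $S$ is a set of rules $u\to v$ ($u,v\in\Sigma^*$); closed if $u\to v\in S\Rightarrow\bar u\to\bar v\in S$; context-free if all rules have form $a\to u$, $a\in\Sigma$. $L_a(S)=\{u\mid a\Rightarrow_S u\}$. Formulae are in negation normal form. A nested sequent is a finite multiset of formulae and structures $a\{\Delta\}$ (comma = multiset union), viewed as a tree with nodes carrying multisets of formulae and $\Sigma$-labelled edges. Contexts $\Gamma[\ ]$, $\Gamma[\ ]_i[\ ]_j$ have holes at nodes. $\mathcal R(\Gamma,i,j)$: automaton with the nodes as states, initial $i$, final $j$, transitions $x\xrightarrow{a}y$, $y\xrightarrow{\bar a}x$ for each edge $x\xrightarrow{a}y$. $\mathrm{DKm}(S)$ rules (conclusion from premises): $\mathit{id}_d$: $\Gamma[p,\neg p]$; $\land_d$: $\Gamma[A\land B]$ from $\Gamma[A\land B,A]$, $\Gamma[A\land B,B]$; $\lor_d$: $\Gamma[A\lor B]$ from $\Gamma[A\lor B,A,B]$; $[a]_d$: $\Gamma[[a]A]$ from $\Gamma[[a]A,a\{A\}]$; $\langle a\rangle\!\uparrow$: $\Gamma[a\{\Delta\},\langle a\rangle A]$ from $\Gamma[a\{\Delta,A\},\langle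 a\rangle A]$; $\langle a\rangle\!\downarrow$: $\Gamma[a\{\Delta,\langle\bar a\rangle A\}]$ from $\Gamma[a\{\Delta,\langle\bar a\rangle A\},A]$; $p_S$: $\Gamma[\langle a\rangle A]_i[\emptyset]_j$ from $\Gamma[\langle a\rangle A]_i[A]_j$ provided $\mathcal R(\Gamma[\ ]_i[\ ]_j,i,j)\cap L_a(S)\neq\emptyset$. -}

module Defs where

open import Data.Nat using (ℕ)
open import Data.Fin using (Fin)
open import Data.List using (List; []; _∷_; _++_; map; reverse; [_])
open import Data.List.Membership.Propositional using (_∈_)
open import Data.List.Relation.Unary.Any using (here; there)
open import Data.Product using (Σ; ∃; _×_; _,_)
open import Relation.Binary.PropositionalEquality using (_≡_; refl)
open import Relation.Binary.Construct.Closure.ReflexiveTransitive using (Star)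

Alphabet : ℕ → Set
Alphabet n = Fin n

barWord : ∀ {n} → (Fin n → Fin n) → List (Fin n) → List (Fin n)
barWord bar u = reverse (map bar u)

SemiThue : ℕ → Set₁
SemiThue n = List (Fin n) → List (Fin n) → Set

data Step {n} (S : SemiThue n) : List (Fin n) → List (Fin n) → Set where
  step : ∀ x y {u v} → S u v → Step S (x ++ u ++ y) (x ++ v ++ y)

_⇒*⟨_⟩_ : ∀ {n} → List (Fin n) → SemiThue n → List (Fin n) → Set
u ⇒*⟨ S ⟩ v = Star (Step S) u v

Lang : ∀ {n} → SemiThue n → Fin n → List (Fin n) → Set
Lang S a u = [ a ] ⇒*⟨ S ⟩ u

Closed : ∀ {n} → (Fin n → Fin n) → SemiThue n → Set
Closed bar S = ∀ u v → S u v → S (barWord bar u) (barWord bar v)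

ContextFree : ∀ {n} → SemiThue n → Set
ContextFree S = ∀ u v → S u v → ∃ λ a → u ≡ [ a ]

data Fml (n : ℕ) : Set where
  atom  : ℕ → Fml n
  natom : ℕ → Fml n
  _∧_   : Fml n → Fml n → Fml n
  _∨_   : Fml n → Fml n → Fml n
  box   : Fin n → Fml n → Fml n
  dia   : Fin n → Fml n → Fml n

-- Nested sequents: a (multi)set of items, each a formula or a
-- structure a{Δ}.  Lists are used; all rules below only refer to
-- membership and insertion, so the order of elements is irrelevant.

data Item (n : ℕ) : Set
Seq : ℕ → Set
Seq n = List (Item n)

data Item n where
  fm : Fml n → Item n
  br : Fin n → Seq n → Item n

data Pos {n} : Seq n → Set where
  root  : ∀ {Γ} → Pos Γ
  child : ∀ {Γ a Δ} → br a Δ ∈ Γ → Pos Δ → Pos Γ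

at : ∀ {n} (Γ : Seq n) → Pos Γ → Seq n
at Γ root = Γ
at Γ (child {Δ = Δ} m p) = at Δ p

ins  : ∀ {n} (Γ : Seq n) → Pos Γ → Seq n → Seq n
insM : ∀ {n a Δ} (Γ : Seq n) → br a Δ ∈ Γ → Pos Δ → Seq n → Seq n
ins Γ root Θ = Γ ++ Θ
ins Γ (child m p) Θ = insM Γ m p Θ
insM {a = a} {Δ} (x ∷ Γ) (here refl) p Θ = br a (ins Δ p Θ) ∷ Γ
insM (x ∷ Γ) (there m) p Θ = x ∷ insM Γ m p Θ

data Edge {n} : {Γ : Seq n} → Pos Γ → Fin n → Pos Γ → Set where
  top  : ∀ {Γ a Δ} (m : br a Δ ∈ Γ) → Edge {Γ = Γ} root a (child m root)
  down : ∀ {Γ b Δ} (m : br b Δ ∈ Γ) {i : Pos Δ} {a} {j : Pos Δ} →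
         Edge i a j → Edge (child m i) a (child m j)

-- Runs of the automaton R(Γ,i,j): transitions x -a-> y and y -bar a-> x
-- for every edge x -a-> y.  Walk bar Γ i w j: w labels a run from i to j.
data Walk {n} (bar : Fin n → Fin n) {Γ : Seq n} : Pos Γ → List (Fin n) → Pos Γ → Set where
  stop : ∀ {i} → Walk bar i [] i
  fwd  : ∀ {i a k w j} → Edge i a k → Walk bar k w j → Walk bar i (a ∷ w) j
  bwd  : ∀ {i a k w j} → Edge k a i → Walk bar k w j → Walk bar i (bar a ∷ w) j

data DKm {n} (bar : Fin n → Fin n) (S : SemiThue n) : Seq n → Set where
  id-d  : ∀ {Γ} (i : Pos Γ) {p} →
          fm (atom p) ∈ at Γ i → fm (natom p) ∈ at Γ i → DKm bar S Γ
  ∧-d   : ∀ {Γ} (i : Pos Γ) {A B} → fm (A ∧ B) ∈ at Γ i →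
          DKm bar S (ins Γ i [ fm A ]) → DKm bar S (ins Γ i [ fm B ]) → DKm bar S Γ
  ∨-d   : ∀ {Γ} (i : Pos Γ) {A B} → fm (A ∨ B) ∈ at Γ i →
          DKm bar S (ins Γ i (fm A ∷ fm B ∷ [])) → DKm bar S Γ
  box-d : ∀ {Γ} (i : Pos Γ) {a A} → fm (box a A) ∈ at Γ i →
          DKm bar S (ins Γ i [ br a [ fm A ] ]) → DKm bar S Γ
  dia↑  : ∀ {Γ} (i j : Pos Γ) {a A} → fm (dia a A) ∈ at Γ i → Edge i a j →
          DKm bar S (ins Γ j [ fm A ]) → DKm bar S Γ
  dia↓  : ∀ {Γ} (i j : Pos Γ) {a A} → Edge i a j → fm (dia (bar a) A) ∈ at Γ j →
          DKm bar S (ins Γ i [ fm A ]) → DKm bar S Γ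
  p-S   : ∀ {Γ} (i j : Pos Γ) {a A w} → fm (dia a A) ∈ at Γ i →
          Walk bar i w j → Lang S a w →
          DKm bar S (ins Γ j [ fm A ]) → DKm bar S Γ

-- Every rule of DKm(S) keeps its principal formula and only asks for
-- formulae at nodes, edges between nodes and walks along edges.  All of
-- these are preserved by a simulation T ⊑ U (every formula of a node
-- reappears at its image, every a-child has an a-child image), so
-- derivability is upward closed under simulations.  Since Γ,Δ,Δ ⊆ Γ,Δ
-- is such a simulation (it merges the two copies of Δ), contraction is
-- admissible.
module Submission where

open import Defs
open import Data.Nat using (ℕ)
open import Data.Fin using (Fin)
open import Data.List using ([]; _∷_; _++_; [_])
open import Data.List.Membership.Propositional using (_∈_; lose)
open import Data.List.Membership.Propositional.Properties using (∈-++⁻)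
open import Data.List.Relation.Binary.Subset.Propositional using (_⊆_)
open import Data.List.Relation.Binary.Subset.Propositional.Properties using (xs⊆xs++ys; xs⊆ys++xs; ++⁺ʳ)
open import Data.List.Relation.Unary.Any as Any using (Any; here; there)
open import Data.Sum as Sum using (_⊎_; inj₁; inj₂; reduce; [_,_])
open import Function using (_∘_)
open import Relation.Binary.PropositionalEquality using (_≡_; refl)

module _ {n : ℕ} where

  infix 4 _≤ᵢ_ _⊑_

  data _≤ᵢ_ : Item n → Item n → Set
  record _⊑_ (T U : Seq n) : Set

  data _≤ᵢ_ where
    fm≤ : ∀ {A} → fm A ≤ᵢ fm A
    br≤ : ∀ {a Δ Δ'} → Δ ⊑ Δ' → br a Δ ≤ᵢ br a Δ'

  record _⊑_ T U where
    inductive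
    no-eta-equality
    pattern
    constructor sim
    field simulate : ∀ {x} → x ∈ T → Any (x ≤ᵢ_) U

  open _⊑_

  ≤ᵢ-refl : (x : Item n) → x ≤ᵢ x
  ⊑-refl : (T : Seq n) → T ⊑ T
  ≤ᵢ-refl (fm A) = fm≤
  ≤ᵢ-refl (br a Δ) = br≤ (⊑-refl Δ)
  ⊑-refl [] = sim λ ()
  ⊑-refl (x ∷ T) = sim λ where
    (here refl) → here (≤ᵢ-refl x)
    (there x∈T) → there (simulate (⊑-refl T) x∈T)

  ≤ᵢ-trans : ∀ {x y z} → x ≤ᵢ y → y ≤ᵢ z → x ≤ᵢ z
  ⊑-trans : ∀ {T U V} → T ⊑ U → U ⊑ V → T ⊑ V
  any-≤ᵢ-⊑ : ∀ {x U V} → Any (x ≤ᵢ_) U → U ⊑ V → Any (x ≤ᵢ_) V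
  ≤ᵢ-trans fm≤ fm≤ = fm≤
  ≤ᵢ-trans (br≤ Δ⊑Δ') (br≤ Δ'⊑Δ'') = br≤ (⊑-trans Δ⊑Δ' Δ'⊑Δ'')
  ⊑-trans (sim f) U⊑V = sim λ x∈T → any-≤ᵢ-⊑ (f x∈T) U⊑V
  any-≤ᵢ-⊑ (here x≤y) (sim g) = Any.map (≤ᵢ-trans x≤y) (g (here refl))
  any-≤ᵢ-⊑ (there x≤U) (sim g) = any-≤ᵢ-⊑ x≤U (sim (g ∘ there))

  ⊆⇒⊑ : ∀ {T U} → T ⊆ U → T ⊑ U
  ⊆⇒⊑ {U = U} T⊆U = sim (simulate (⊑-refl U) ∘ T⊆U)

  ⊑-join : ∀ {X Y Z U} → (∀ {x} → x ∈ X → x ∈ Y ⊎ x ∈ Z) → Y ⊑ U → Z ⊑ U → X ⊑ U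
  ⊑-join split (sim f) (sim g) = sim λ x∈X → [ f , g ] (split x∈X)

  fm-image : ∀ {T U A} → T ⊑ U → fm A ∈ T → fm A ∈ U
  fm-image (sim f) A∈T = image (f A∈T)
    where
    image : ∀ {A U} → Any (fm A ≤ᵢ_) U → fm A ∈ U
    image (here fm≤) = here refl
    image (there A≤U) = there (image A≤U)

  record BranchImage (U : Seq n) (a : Fin n) (Δ : Seq n) : Set where
    constructor branch
    field
      {target} : Seq n
      member : br a target ∈ U
      simulation : Δ ⊑ target

  open BranchImage

  br-image : ∀ {T U a Δ} → T ⊑ U → br a Δ ∈ T → BranchImage U a Δ
  br-image (sim f) Δ∈T = image (f Δ∈T)
    where
    image : ∀ {a Δ U} → Any (br a Δ ≤ᵢ_) U → BranchImage U a Δ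
    image (here (br≤ Δ⊑Δ')) = branch (here refl) Δ⊑Δ'
    image (there Δ≤U) = let branch m s = image Δ≤U in branch (there m) s

  pos-map : ∀ {T U} → T ⊑ U → Pos T → Pos U
  pos-map T⊑U root = root
  pos-map T⊑U (child m p) = let b = br-image T⊑U m in child (member b) (pos-map (simulation b) p)

  at-⊑ : ∀ {T U} (T⊑U : T ⊑ U) (i : Pos T) → at T i ⊑ at U (pos-map T⊑U i)
  at-⊑ T⊑U root = T⊑U
  at-⊑ T⊑U (child m p) = at-⊑ (simulation (br-image T⊑U m)) p

  edge-map : ∀ {T U} (T⊑U : T ⊑ U) {i a j} → Edge i a j → Edge (pos-map T⊑U i) a (pos-map T⊑U j)
  edge-map T⊑U (top m) = top (member (br-image T⊑U m))
  edge-map T⊑U (down m e) = down (member (br-image T⊑U m)) (edge-map (simulation (br-image T⊑U m)) e)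

  walk-map : ∀ {bar T U} (T⊑U : T ⊑ U) {i w j} → Walk bar i w j → Walk bar (pos-map T⊑U i) w (pos-map T⊑U j)
  walk-map T⊑U stop = stop
  walk-map T⊑U (fwd e w) = fwd (edge-map T⊑U e) (walk-map T⊑U w)
  walk-map T⊑U (bwd e w) = bwd (edge-map T⊑U e) (walk-map T⊑U w)

  fm-at : ∀ {T U A} (T⊑U : T ⊑ U) (i : Pos T) → fm A ∈ at T i → fm A ∈ at U (pos-map T⊑U i)
  fm-at T⊑U i = fm-image (at-⊑ T⊑U i)

  ∈-insM-here : ∀ {Y a Δ} (m : br a Δ ∈ Y) (q : Pos Δ) (Θ : Seq n) → br a (ins Δ q Θ) ∈ insM Y m q Θ
  ∈-insM-here (here refl) q Θ = here refl
  ∈-insM-here (there m) q Θ = there (∈-insM-here m q Θ)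

  ∈-insM⁺ : ∀ {Y a Δ x} (m : br a Δ ∈ Y) (q : Pos Δ) (Θ : Seq n) → x ∈ Y → x ∈ insM Y m q Θ ⊎ x ∈ [ br a Δ ]
  ∈-insM⁺ (here refl) q Θ (here x≡) = inj₂ (here x≡)
  ∈-insM⁺ (here refl) q Θ (there x∈Y) = inj₁ (there x∈Y)
  ∈-insM⁺ (there m) q Θ (here x≡) = inj₁ (here x≡)
  ∈-insM⁺ (there m) q Θ (there x∈Y) = Sum.map₁ there (∈-insM⁺ m q Θ x∈Y)

  ∈-insM⁻ : ∀ {Y a Δ x} (m : br a Δ ∈ Y) (q : Pos Δ) (Θ : Seq n) → x ∈ insM Y m q Θ → x ∈ Y ⊎ x ∈ [ br a (ins Δ q Θ) ]
  ∈-insM⁻ (here refl) q Θ (here x≡) = inj₂ (here x≡)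
  ∈-insM⁻ (here refl) q Θ (there x∈Y) = inj₁ (there x∈Y)
  ∈-insM⁻ (there m) q Θ (here x≡) = inj₁ (here x≡)
  ∈-insM⁻ (there m) q Θ (there x∈Y) = Sum.map₁ there (∈-insM⁻ m q Θ x∈Y)

  singleton-⊑ : ∀ {x U} → Any (x ≤ᵢ_) U → [ x ] ⊑ U
  singleton-⊑ x≤U = sim λ { (here refl) → x≤U }

  ⊑-ins : (Y : Seq n) (q : Pos Y) (Θ : Seq n) → Y ⊑ ins Y q Θ
  ⊑-ins Y root Θ = ⊆⇒⊑ (xs⊆xs++ys Y Θ)
  ⊑-ins Y (child {Δ = Δ} m q) Θ =
    ⊑-join (∈-insM⁺ m q Θ) (⊑-refl _)
      (singleton-⊑ (lose (∈-insM-here m q Θ) (br≤ (⊑-ins Δ q Θ))))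

  ins-mono : ∀ {T U} (T⊑U : T ⊑ U) (i : Pos T) (Θ : Seq n) → ins T i Θ ⊑ ins U (pos-map T⊑U i) Θ
  ins-mono {T} {U} T⊑U root Θ =
    ⊑-join (∈-++⁻ T) (⊑-trans T⊑U (⊑-ins U root Θ)) (⊆⇒⊑ (xs⊆ys++xs Θ U))
  ins-mono {U = U} T⊑U (child m p) Θ =
    ⊑-join (∈-insM⁻ m p Θ) (⊑-trans T⊑U (⊑-ins U (pos-map T⊑U (child m p)) Θ))
      (singleton-⊑ (lose (∈-insM-here (member b) (pos-map (simulation b) p) Θ) (br≤ (ins-mono (simulation b) p Θ))))
    where b = br-image T⊑U m

  DKm-mono : ∀ {bar S T U} → T ⊑ U → DKm bar S T → DKm bar S U
  DKm-mono h (id-d i p∈ ¬p∈) = id-d (pos-map h i) (fm-at h i p∈) (fm-at h i ¬p∈)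
  DKm-mono h (∧-d i A∧B∈ dA dB) =
    ∧-d (pos-map h i) (fm-at h i A∧B∈) (DKm-mono (ins-mono h i _) dA) (DKm-mono (ins-mono h i _) dB)
  DKm-mono h (∨-d i A∨B∈ d) = ∨-d (pos-map h i) (fm-at h i A∨B∈) (DKm-mono (ins-mono h i _) d)
  DKm-mono h (box-d i □A∈ d) = box-d (pos-map h i) (fm-at h i □A∈) (DKm-mono (ins-mono h i _) d)
  DKm-mono h (dia↑ i j ◇A∈ e d) =
    dia↑ (pos-map h i) (pos-map h j) (fm-at h i ◇A∈) (edge-map h e) (DKm-mono (ins-mono h j _) d)
  DKm-mono h (dia↓ i j e ◇A∈ d) =
    dia↓ (pos-map h i) (pos-map h j) (edge-map h e) (fm-at h j ◇A∈) (DKm-mono (ins-mono h i _) d)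
  DKm-mono h (p-S i j ◇A∈ w a⇒w d) =
    p-S (pos-map h i) (pos-map h j) (fm-at h i ◇A∈) (walk-map h w) a⇒w (DKm-mono (ins-mono h j _) d)

lemma4p8 : (n : ℕ) (bar : Fin n → Fin n) → (∀ a → bar (bar a) ≡ a) →
           (S : SemiThue n) → Closed bar S → ContextFree S →
           (Γ Δ : Seq n) → DKm bar S (Γ ++ Δ ++ Δ) → DKm bar S (Γ ++ Δ)
lemma4p8 _ _ _ _ _ _ Γ Δ = DKm-mono (⊆⇒⊑ (++⁺ʳ Γ (reduce ∘ ∈-++⁻ Δ)))
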